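{- Let $p\ge 2$ be an integer. Define integers $B_p(n,k_1,\dots,k_{p-1})$, for $n\ge 1$ and $k_1,\dots,k_{p-1}\ge 0$, by: $B_p(1,0,\dots,0)=1$; for $n>1$ and $0\le k_1+\cdots+k_{p-1}<n$, $$B_p(n,k_1,\dots,k_{p-1})=\sum_{0\le i_1\le k_1,\dots,0\le i_{p-1}\le k_{p-1}} B_p(n-1,i_1,\dots,i_{p-1});$$ and $B_p(n,k_1,\dots,k_{p-1})=0$ whenever $k_1+\cdots+k_{p-1}\ge n$. Then for every $n\ge 1$, $$\sum_{k_1,\dots,k_{p-1}\ge 0} B_p(n,k_1,\dots,k_{p-1})=C_p(n)=\frac{1}{(p-1)n+1}\binom{pn}{n}.$$ -}

module Defs where

open import Data.Nat using (ℕ; zero; suc; _+_; _<ᵇ_)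
open import Data.Bool using (if_then_else_)
open import Data.List using (List; []; _∷_; map; concatMap; upTo)
open import Data.Nat.ListAction using () renaming (sum to lsum)
open import Data.Vec using (Vec; []; _∷_; replicate)
import Data.Vec as V

box : {m : ℕ} → Vec ℕ m → List (Vec ℕ m)
box []       = [] ∷ []
box (k ∷ ks) = concatMap (λ i → map (i ∷_) (box ks)) (upTo (suc k))

boxSum : {m : ℕ} → (Vec ℕ m → ℕ) → Vec ℕ m → ℕ
boxSum f k = lsum (map f (box k))

-- Bm n k  =  B_p(n, k_1, …, k_{p-1})  with m = p - 1 and k = (k_1,…,k_m).
-- Value at n = 0 (not used by the paper) is set to 0.
B : (m : ℕ) → ℕ → Vec ℕ m → ℕ
B m zero          k = 0
B m (suc zero)    k = if V.sum k <ᵇ 1 then 1 else 0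
B m (suc (suc n)) k = if V.sum k <ᵇ suc (suc n) then boxSum (B m (suc n)) k else 0

-- Sum of B_p(n, ·) over all k ≥ 0.  B_p(n,k) = 0 unless k_1+…+k_m < n,
-- so all nonzero terms lie in the box 0 ≤ k_j ≤ n; summing over that box
-- is the (finite-support) infinite sum.
totalB : (m : ℕ) → ℕ → ℕ
totalB m n = boxSum (B m n) (replicate m n)

module Submission where

-- Write m = p − 1 and |k| = k₁ + ⋯ + k_m. Since B(c, k) = 0 unless |k| < c, all sums over k
-- may be taken over the cube [0, n]^m, and the distribution of |k| under B(c + 1, ·) is a
-- ballot sequence:  Σ_k B(c + 1, k) φ(|k|) = Σ_s ballot(m(c + 1) − 1, s) φ(s),  where
-- ballot(a, s) counts the lattice paths from (0, 0) to (a, s) that stay in m·y ≤ x.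
-- The recursion of B sums over a box one coordinate at a time; each coordinate turns
-- ballot(a, ·) into its prefix sums ballot(a + 1, ·), so one step of B raises a by m.
-- Hence Σ_k B(n, k) = ballot(mn, n), and the reflection principle
-- ballot(a, s + 1) = C(a + s + 1, s + 1) − m C(a + s + 1, s) evaluates this to C(pn, n)/(mn + 1).

open import Defs
open import Data.Bool using (true; false; if_then_else_)
open import Data.List using (List; []; _∷_; [_]; _++_; map; concatMap; upTo)
open import Data.List.Properties using (map-++; map-cong; map-∘; map-applyUpTo; map-upTo; upTo-∷ʳ)
open import Data.Nat using (ℕ; zero; suc; _+_; _*_; _∸_; _≤_; _<_; _<ᵇ_; z≤n; s≤s; _≤?_; NonZero; >-nonZero⁻¹)
open import Data.Nat.Combinatorics using (_C_; nCn≡1; nCk+nC[k+1]≡[n+1]C[k+1])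
open import Data.Nat.ListAction using (sum)
open import Data.Nat.ListAction.Properties using (sum-++)
open import Data.Nat.Properties
open import Data.Nat.Tactic.RingSolver using (solve-∀)
open import Data.Vec using (Vec; []; _∷_; replicate)
import Data.Vec as V
open import Function using (_∘_)
open import Relation.Binary.PropositionalEquality using (_≡_; refl; sym; trans; cong; cong₂; module ≡-Reasoning)
open import Relation.Nullary using (yes; no; ofʸ; ofⁿ; contradiction)
open import Algebra.Properties.CommutativeSemigroup +-commutativeSemigroup
  using () renaming (interchange to +-interchange; x∙yz≈y∙xz to +-left-comm)
open import Algebra.Properties.CommutativeSemigroup *-commutativeSemigroup
  using () renaming (x∙yz≈y∙xz to *-left-comm)

private
  variable
    X Y : Set

∑ : List X → (X → ℕ) → ℕ
∑ xs f = sum (map f xs)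

∑-cong : ∀ (xs : List X) {f g : X → ℕ} → (∀ x → f x ≡ g x) → ∑ xs f ≡ ∑ xs g
∑-cong xs f≗g = cong sum (map-cong f≗g xs)

∑-zero : ∀ (xs : List X) {f : X → ℕ} → (∀ x → f x ≡ 0) → ∑ xs f ≡ 0
∑-zero []       f≗0 = refl
∑-zero (x ∷ xs) f≗0 = cong₂ _+_ (f≗0 x) (∑-zero xs f≗0)

∑-+ : ∀ (xs : List X) (f g : X → ℕ) → ∑ xs (λ x → f x + g x) ≡ ∑ xs f + ∑ xs g
∑-+ []       f g = refl
∑-+ (x ∷ xs) f g =
  trans (cong (f x + g x +_) (∑-+ xs f g)) (+-interchange (f x) (g x) (∑ xs f) (∑ xs g))

*-distribˡ-∑ : ∀ (xs : List X) c (f : X → ℕ) → c * ∑ xs f ≡ ∑ xs (λ x → c * f x)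
*-distribˡ-∑ []       c f = *-zeroʳ c
*-distribˡ-∑ (x ∷ xs) c f =
  trans (*-distribˡ-+ c (f x) (∑ xs f)) (cong (c * f x +_) (*-distribˡ-∑ xs c f))

∑-comm : (xs : List X) (ys : List Y) (h : X → Y → ℕ) →
  ∑ xs (λ x → ∑ ys (h x)) ≡ ∑ ys (λ y → ∑ xs (λ x → h x y))
∑-comm []       ys h = sym (∑-zero ys (λ _ → refl))
∑-comm (x ∷ xs) ys h = trans (cong (∑ ys (h x) +_) (∑-comm xs ys h)) (sym (∑-+ ys (h x) _))

∑-*-∑-comm : (xs : List X) (ys : List Y) (c : X → ℕ) (h : X → Y → ℕ) →
  ∑ xs (λ x → c x * ∑ ys (h x)) ≡ ∑ ys (λ y → ∑ xs (λ x → c x * h x y))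
∑-*-∑-comm xs ys c h =
  trans (∑-cong xs (λ x → *-distribˡ-∑ ys (c x) (h x))) (∑-comm xs ys (λ x y → c x * h x y))

∑-++ : ∀ (xs ys : List X) (f : X → ℕ) → ∑ (xs ++ ys) f ≡ ∑ xs f + ∑ ys f
∑-++ xs ys f = trans (cong sum (map-++ f xs ys)) (sum-++ (map f xs) (map f ys))

∑-map : (xs : List X) (g : X → Y) (f : Y → ℕ) → ∑ (map g xs) f ≡ ∑ xs (f ∘ g)
∑-map xs g f = cong sum (sym (map-∘ xs))

∑-concatMap : (xs : List X) (g : X → List Y) (f : Y → ℕ) →
  ∑ (concatMap g xs) f ≡ ∑ xs (λ x → ∑ (g x) f)
∑-concatMap []       g f = refl
∑-concatMap (x ∷ xs) g f =
  trans (∑-++ (g x) (concatMap g xs) f) (cong (∑ (g x) f +_) (∑-concatMap xs g f))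

∑< : ℕ → (ℕ → ℕ) → ℕ
∑< n = ∑ (upTo n)

∑<-cong : ∀ n {g h : ℕ → ℕ} → (∀ i → g i ≡ h i) → ∑< n g ≡ ∑< n h
∑<-cong n = ∑-cong (upTo n)

∑<-head : ∀ n g → ∑< (suc n) g ≡ g 0 + ∑< n (g ∘ suc)
∑<-head n g =
  cong (λ xs → g 0 + sum xs) (trans (map-applyUpTo suc g n) (sym (map-upTo (g ∘ suc) n)))

∑<-last : ∀ n g → ∑< (suc n) g ≡ ∑< n g + g n
∑<-last n g = begin
  ∑< (suc n) g           ≡⟨ cong (λ xs → ∑ xs g) (sym (upTo-∷ʳ n)) ⟩
  ∑ (upTo n ++ [ n ]) g  ≡⟨ ∑-++ (upTo n) [ n ] g ⟩
  ∑< n g + (g n + 0)     ≡⟨ cong (∑< n g +_) (+-identityʳ (g n)) ⟩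
  ∑< n g + g n           ∎
  where open ≡-Reasoning

∑<-triangle : ∀ n (h : ℕ → ℕ → ℕ) → (∀ a b → n ≤ a → h a b ≡ 0) →
  ∑< n (λ a → ∑< (suc a) (h a)) ≡ ∑< n (λ b → ∑< n (λ d → h (b + d) b))
∑<-triangle zero    h h≡0 = refl
∑<-triangle (suc n) h h≡0 = begin
  ∑< (suc n) (λ a → ∑< (suc a) (h a))
    ≡⟨ ∑<-cong (suc n) (λ a → ∑<-head a (h a)) ⟩
  ∑< (suc n) (λ a → h a 0 + ∑< a (h a ∘ suc))
    ≡⟨ ∑-+ (upTo (suc n)) (λ a → h a 0) _ ⟩
  column₀ + ∑< (suc n) (λ a → ∑< a (h a ∘ suc))
    ≡⟨ cong (column₀ +_) (∑<-head n (λ a → ∑< a (h a ∘ suc))) ⟩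
  column₀ + ∑< n (λ a → ∑< (suc a) (h (suc a) ∘ suc))
    ≡⟨ cong (column₀ +_) (∑<-triangle n h′ (λ a b n≤a → h≡0 (suc a) (suc b) (s≤s n≤a))) ⟩
  column₀ + ∑< n (λ b → ∑< n (λ d → h′ (b + d) b))
    ≡⟨ cong (column₀ +_) (∑<-cong n (λ b → sym (extend b))) ⟩
  column₀ + ∑< n (λ b → ∑< (suc n) (λ d → h′ (b + d) b))
    ≡⟨ sym (∑<-head n _) ⟩
  ∑< (suc n) (λ b → ∑< (suc n) (λ d → h (b + d) b)) ∎
  where
  open ≡-Reasoning
  column₀ = ∑< (suc n) (λ a → h a 0)
  h′ : ℕ → ℕ → ℕ
  h′ a b = h (suc a) (suc b)
  extend : ∀ b → ∑< (suc n) (λ d → h′ (b + d) b) ≡ ∑< n (λ d → h′ (b + d) b)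
  extend b = begin
    ∑< (suc n) (λ d → h′ (b + d) b)    ≡⟨ ∑<-last n _ ⟩
    ∑< n (λ d → h′ (b + d) b) + h′ (b + n) b
      ≡⟨ cong (∑< n (λ d → h′ (b + d) b) +_) (h≡0 (suc (b + n)) (suc b) (s≤s (m≤n+m n b))) ⟩
    ∑< n (λ d → h′ (b + d) b) + 0      ≡⟨ +-identityʳ _ ⟩
    ∑< n (λ d → h′ (b + d) b)          ∎

∑<-prefixSum-exchange : ∀ n (x g : ℕ → ℕ) → (∀ u → n ≤ u → g u ≡ 0) →
  ∑< n (λ s → x s * ∑< n (λ d → g (s + d))) ≡ ∑< n (λ u → g u * ∑< (suc u) x)
∑<-prefixSum-exchange n x g g≡0 = begin
  ∑< n (λ s → x s * ∑< n (λ d → g (s + d)))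
    ≡⟨ ∑<-cong n (λ s → trans (*-distribˡ-∑ (upTo n) (x s) _)
                              (∑<-cong n (λ d → *-comm (x s) (g (s + d))))) ⟩
  ∑< n (λ b → ∑< n (λ d → g (b + d) * x b))
    ≡⟨ sym (∑<-triangle n (λ a b → g a * x b) (λ a b n≤a → cong (_* x b) (g≡0 a n≤a))) ⟩
  ∑< n (λ a → ∑< (suc a) (λ b → g a * x b))
    ≡⟨ ∑<-cong n (λ a → sym (*-distribˡ-∑ (upTo (suc a)) (g a) x)) ⟩
  ∑< n (λ u → g u * ∑< (suc u) x) ∎
  where open ≡-Reasoning

boxSum-∷ : ∀ {j} (f : Vec ℕ (suc j) → ℕ) k (ks : Vec ℕ j) →
  boxSum f (k ∷ ks) ≡ ∑< (suc k) (λ i → boxSum (f ∘ (i ∷_)) ks)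
boxSum-∷ f k ks = trans (∑-concatMap (upTo (suc k)) (λ i → map (i ∷_) (box ks)) f)
                        (∑<-cong (suc k) (λ i → ∑-map (box ks) (i ∷_) f))

cubeSum : ℕ → ℕ → (ℕ → ℕ) → ℕ
cubeSum j N χ = boxSum (χ ∘ V.sum) (replicate j N)

cubeSum-suc : ∀ j N χ → cubeSum (suc j) N χ ≡ ∑< (suc N) (λ d → cubeSum j N (λ u → χ (d + u)))
cubeSum-suc j N χ = boxSum-∷ (χ ∘ V.sum) N (replicate j N)

cubeSum-cong : ∀ j N {χ χ′ : ℕ → ℕ} → (∀ u → χ u ≡ χ′ u) → cubeSum j N χ ≡ cubeSum j N χ′
cubeSum-cong j N χ≗χ′ = ∑-cong (box (replicate j N)) (χ≗χ′ ∘ V.sum)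

cubeSum-zero : ∀ j N {χ : ℕ → ℕ} → (∀ u → χ u ≡ 0) → cubeSum j N χ ≡ 0
cubeSum-zero j N χ≗0 = ∑-zero (box (replicate j N)) (χ≗0 ∘ V.sum)

cubeSum-origin : ∀ j N (χ : ℕ → ℕ) → (∀ u → χ (suc u) ≡ 0) → cubeSum j N χ ≡ χ 0
cubeSum-origin zero    N χ χ≗0 = +-identityʳ (χ 0)
cubeSum-origin (suc j) N χ χ≗0 = begin
  cubeSum (suc j) N χ                                  ≡⟨ cubeSum-suc j N χ ⟩
  ∑< (suc N) (λ d → cubeSum j N (λ u → χ (d + u)))     ≡⟨ ∑<-head N _ ⟩
  cubeSum j N χ + ∑< N (λ d → cubeSum j N (λ u → χ (suc d + u)))
    ≡⟨ cong₂ _+_ (cubeSum-origin j N χ χ≗0)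
                 (∑-zero (upTo N) (λ d → cubeSum-zero j N (λ u → χ≗0 (d + u)))) ⟩
  χ 0 + 0                                              ≡⟨ +-identityʳ (χ 0) ⟩
  χ 0                                                  ∎
  where open ≡-Reasoning

-- Swap the sums over i ≤ k and substitute k = i + v; the k outside the cube have |k| > N,
-- so ψ kills them.
boxSum-prefixSum-exchange : ∀ j N (f : Vec ℕ j → ℕ) (ψ : ℕ → ℕ) → (∀ u → N < u → ψ u ≡ 0) →
  boxSum (λ k → ψ (V.sum k) * boxSum f k) (replicate j N)
    ≡ boxSum (λ i → f i * cubeSum j N (λ u → ψ (V.sum i + u))) (replicate j N)
boxSum-prefixSum-exchange zero N f ψ ψ≡0 = swap (ψ 0) (f [])
  where
  swap : ∀ x y → x * (y + 0) + 0 ≡ y * (x + 0) + 0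
  swap = solve-∀
boxSum-prefixSum-exchange (suc j) N f ψ ψ≡0 = begin
  boxSum (λ k → ψ (V.sum k) * boxSum f k) (N ∷ cube)
    ≡⟨ boxSum-∷ _ N cube ⟩
  ∑< (suc N) (λ a → boxSum (λ ks → ψ (a + V.sum ks) * boxSum f (a ∷ ks)) cube)
    ≡⟨ ∑<-cong (suc N) (λ a → ∑-cong (box cube) (λ ks →
         cong (ψ (a + V.sum ks) *_) (boxSum-∷ f a ks))) ⟩
  ∑< (suc N) (λ a → boxSum (λ ks →
    ψ (a + V.sum ks) * ∑< (suc a) (λ b → boxSum (f ∘ (b ∷_)) ks)) cube)
    ≡⟨ ∑<-cong (suc N) (λ a → ∑-*-∑-comm (box cube) (upTo (suc a))
         (λ ks → ψ (a + V.sum ks)) (λ ks b → boxSum (f ∘ (b ∷_)) ks)) ⟩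
  ∑< (suc N) (λ a → ∑< (suc a) (λ b →
    boxSum (λ ks → ψ (a + V.sum ks) * boxSum (f ∘ (b ∷_)) ks) cube))
    ≡⟨ ∑<-cong (suc N) (λ a → ∑<-cong (suc a) (λ b →
         boxSum-prefixSum-exchange j N (f ∘ (b ∷_)) (λ u → ψ (a + u))
           (λ u N<u → ψ≡0 (a + u) (≤-trans N<u (m≤n+m u a))))) ⟩
  ∑< (suc N) (λ a → ∑< (suc a) (H a))
    ≡⟨ ∑<-triangle (suc N) H H≡0 ⟩
  ∑< (suc N) (λ b → ∑< (suc N) (λ d → H (b + d) b))
    ≡⟨ ∑<-cong (suc N) (λ b → ∑-*-∑-comm (box cube) (upTo (suc N))
         (f ∘ (b ∷_)) (λ is d → cubeSum j N (λ u → ψ ((b + d) + (V.sum is + u))))) ⟨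
  ∑< (suc N) (λ b → boxSum (λ is → f (b ∷ is) *
    ∑< (suc N) (λ d → cubeSum j N (λ u → ψ ((b + d) + (V.sum is + u))))) cube)
    ≡⟨ ∑<-cong (suc N) (λ b → ∑-cong (box cube) (λ is → cong (f (b ∷ is) *_) (begin
         ∑< (suc N) (λ d → cubeSum j N (λ u → ψ ((b + d) + (V.sum is + u))))
           ≡⟨ ∑<-cong (suc N) (λ d → cubeSum-cong j N (λ u →
                cong ψ (+-interchange b d (V.sum is) u))) ⟩
         ∑< (suc N) (λ d → cubeSum j N (λ u → ψ ((b + V.sum is) + (d + u))))
           ≡⟨ cubeSum-suc j N (λ u → ψ ((b + V.sum is) + u)) ⟨
         cubeSum (suc j) N (λ u → ψ ((b + V.sum is) + u)) ∎))) ⟩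
  ∑< (suc N) (λ b → boxSum (λ is →
    f (b ∷ is) * cubeSum (suc j) N (λ u → ψ ((b + V.sum is) + u))) cube)
    ≡⟨ boxSum-∷ _ N cube ⟨
  boxSum (λ i → f i * cubeSum (suc j) N (λ u → ψ (V.sum i + u))) (N ∷ cube) ∎
  where
  open ≡-Reasoning
  cube = replicate j N
  H : ℕ → ℕ → ℕ
  H a b = boxSum (λ is → f (b ∷ is) * cubeSum j N (λ u → ψ (a + (V.sum is + u)))) cube
  H≡0 : ∀ a b → suc N ≤ a → H a b ≡ 0
  H≡0 a b N<a = ∑-zero (box cube) (λ is → trans
    (cong (f (b ∷ is) *_) (cubeSum-zero j N (λ u → ψ≡0 _ (≤-trans N<a (m≤m+n a (V.sum is + u))))))
    (*-zeroʳ (f (b ∷ is))))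

paths : ℕ → ℕ → ℕ
paths a       zero    = 1
paths zero    (suc s) = 1
paths (suc a) (suc s) = paths a (suc s) + paths (suc a) s

paths≡C : ∀ a s → paths a s ≡ (a + s) C s
paths≡C a       zero    = refl
paths≡C zero    (suc s) = sym (nCn≡1 (suc s))
paths≡C (suc a) (suc s) = begin
  paths a (suc s) + paths (suc a) s          ≡⟨ cong₂ _+_ (paths≡C a (suc s)) (paths≡C (suc a) s) ⟩
  (a + suc s) C suc s + (suc a + s) C s      ≡⟨ cong (λ n → (a + suc s) C suc s + n C s) (+-suc a s) ⟨
  (a + suc s) C suc s + (a + suc s) C s      ≡⟨ +-comm ((a + suc s) C suc s) _ ⟩
  (a + suc s) C s + (a + suc s) C suc s      ≡⟨ nCk+nC[k+1]≡[n+1]C[k+1] (a + suc s) s ⟩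
  suc (a + suc s) C suc s                    ∎
  where open ≡-Reasoning

paths[a,1]≡1+a : ∀ a → paths a 1 ≡ suc a
paths[a,1]≡1+a zero    = refl
paths[a,1]≡1+a (suc a) = trans (cong (_+ 1) (paths[a,1]≡1+a a)) (+-comm (suc a) 1)

paths[1,s]≡1+s : ∀ s → paths 1 s ≡ suc s
paths[1,s]≡1+s zero    = refl
paths[1,s]≡1+s (suc s) = cong suc (paths[1,s]≡1+s s)

paths-absorption : ∀ a s → suc s * paths a (suc s) ≡ suc a * paths (suc a) s
paths-absorption zero    s       =
  trans (*-identityʳ (suc s)) (sym (trans (+-identityʳ (paths 1 s)) (paths[1,s]≡1+s s)))
paths-absorption (suc a) zero    =
  trans (+-identityʳ (paths (suc a) 1)) (trans (paths[a,1]≡1+a (suc a)) (sym (*-identityʳ (suc (suc a)))))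
paths-absorption (suc a) (suc s) = begin
  suc (suc s) * (paths a (suc (suc s)) + x)
    ≡⟨ *-distribˡ-+ (suc (suc s)) (paths a (suc (suc s))) x ⟩
  suc (suc s) * paths a (suc (suc s)) + suc (suc s) * x
    ≡⟨ cong (_+ suc (suc s) * x) (paths-absorption a (suc s)) ⟩
  suc a * x + suc (suc s) * x
    ≡⟨ regroup a s x ⟩
  suc (suc a) * x + suc s * x
    ≡⟨ cong (suc (suc a) * x +_) (paths-absorption (suc a) s) ⟩
  suc (suc a) * x + suc (suc a) * paths (suc (suc a)) s
    ≡⟨ *-distribˡ-+ (suc (suc a)) x _ ⟨
  suc (suc a) * paths (suc (suc a)) (suc s) ∎
  where
  open ≡-Reasoning
  x = paths (suc a) (suc s)
  regroup : ∀ a s x → suc a * x + suc (suc s) * x ≡ suc (suc a) * x + suc s * x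
  regroup = solve-∀

paths-boundary : ∀ m a s → m * suc s ≡ suc a → m * paths (suc a) s ≡ paths a (suc s)
paths-boundary m a s m[1+s]≡1+a = *-cancelˡ-≡ _ _ (suc s) (begin
  suc s * (m * paths (suc a) s)  ≡⟨ *-assoc (suc s) m _ ⟨
  (suc s * m) * paths (suc a) s  ≡⟨ cong (_* paths (suc a) s) (trans (*-comm (suc s) m) m[1+s]≡1+a) ⟩
  suc a * paths (suc a) s        ≡⟨ paths-absorption a s ⟨
  suc s * paths a (suc s)        ∎)
  where open ≡-Reasoning

module Ballot (m : ℕ) where

  ballot : ℕ → ℕ → ℕ
  ballot a       zero    = 1
  ballot zero    (suc s) = 0
  ballot (suc a) (suc s) with m * suc s ≤? suc a
  ... | yes _ = ballot a (suc s) + ballot (suc a) s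
  ... | no  _ = 0

  ballot-vanish : ∀ a s → a < m * suc s → ballot a (suc s) ≡ 0
  ballot-vanish zero    s a<m[1+s] = refl
  ballot-vanish (suc a) s a<m[1+s] with m * suc s ≤? suc a
  ... | yes m[1+s]≤a = contradiction m[1+s]≤a (<⇒≱ a<m[1+s])
  ... | no  _        = refl

  ballot-prefixSum : ∀ a u → m * u ≤ suc a → ∑< (suc u) (ballot a) ≡ ballot (suc a) u
  ballot-prefixSum a zero    mu≤1+a = refl
  ballot-prefixSum a (suc u) mu≤1+a with m * suc u ≤? suc a
  ... | no  mu≰1+a = contradiction mu≤1+a mu≰1+a
  ... | yes _      = begin
    ∑< (suc (suc u)) (ballot a)          ≡⟨ ∑<-last (suc u) (ballot a) ⟩
    ∑< (suc u) (ballot a) + ballot a (suc u)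
      ≡⟨ cong (_+ ballot a (suc u)) (ballot-prefixSum a u (≤-trans (*-monoʳ-≤ m (n≤1+n u)) mu≤1+a)) ⟩
    ballot (suc a) u + ballot a (suc u)  ≡⟨ +-comm (ballot (suc a) u) (ballot a (suc u)) ⟩
    ballot a (suc u) + ballot (suc a) u  ∎
    where open ≡-Reasoning

  -- A generalized reflection principle; on the line m (s + 1) = a + 1 it is paths-boundary.
  ballot-reflection : .{{NonZero m}} → ∀ a s → m * suc s ≤ suc a →
    ballot a (suc s) + m * paths (suc a) s ≡ paths a (suc s)
  ballot-reflection zero s m[1+s]≤1 =
    paths-boundary m 0 s (≤-antisym m[1+s]≤1 (>-nonZero⁻¹ (m * suc s) {{m*n≢0 m (suc s)}}))
  ballot-reflection (suc a) s m[1+s]≤2+a with m * suc s ≤? suc a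
  ... | no m[1+s]≰1+a = paths-boundary m (suc a) s (≤-antisym m[1+s]≤2+a (≰⇒> m[1+s]≰1+a))
  ballot-reflection (suc a) zero _ | yes m≤1+a =
    trans (regroup (ballot a 1) (m * 1)) (cong (_+ 1) (ballot-reflection a zero m≤1+a))
    where
    regroup : ∀ x y → (x + 1) + y ≡ (x + y) + 1
    regroup = solve-∀
  ballot-reflection (suc a) (suc s) m[2+s]≤2+a | yes m[2+s]≤1+a =
    trans (regroup (ballot a (suc (suc s))) (ballot (suc a) (suc s))
                   (paths (suc a) (suc s)) (paths (suc (suc a)) s) m)
          (cong₂ _+_ (ballot-reflection a (suc s) m[2+s]≤1+a)
                     (ballot-reflection (suc a) s (≤-trans (*-monoʳ-≤ m (n≤1+n (suc s))) m[2+s]≤2+a)))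
    where
    regroup : ∀ x₁ x₂ y₁ y₂ c → (x₁ + x₂) + c * (y₁ + y₂) ≡ (x₁ + c * y₁) + (x₂ + c * y₂)
    regroup = solve-∀

  ballot-closedForm : .{{NonZero m}} → ∀ n →
    suc (m * suc n) * ballot (m * suc n) (suc n) ≡ paths (m * suc n) (suc n)
  ballot-closedForm n = +-cancelʳ-≡ (M * y) (suc M * b) y (begin
    suc M * b + M * y               ≡⟨ cong (suc M * b +_) (*-assoc m (suc n) y) ⟩
    suc M * b + m * (suc n * y)     ≡⟨ cong (λ z → suc M * b + m * z) (paths-absorption M n) ⟩
    suc M * b + m * (suc M * x)     ≡⟨ cong (suc M * b +_) (*-left-comm m (suc M) x) ⟩
    suc M * b + suc M * (m * x)     ≡⟨ *-distribˡ-+ (suc M) b (m * x) ⟨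
    suc M * (b + m * x)             ≡⟨ cong (suc M *_) (ballot-reflection M n (n≤1+n M)) ⟩
    suc M * y                       ∎)
    where
    open ≡-Reasoning
    M = m * suc n
    b = ballot M (suc n)
    x = paths (suc M) n
    y = paths M (suc n)

  ∑<-ballot-cubeSum : ∀ N j a (χ : ℕ → ℕ) c → (∀ u → c < u → χ u ≡ 0) → c ≤ N → m * c ≤ suc a →
    ∑< (suc N) (λ s → ballot a s * cubeSum j N (λ u → χ (s + u)))
      ≡ ∑< (suc N) (λ s → ballot (j + a) s * χ s)
  ∑<-ballot-cubeSum N zero a χ c χ≡0 c≤N mc≤1+a =
    ∑<-cong (suc N) (λ s → cong (ballot a s *_) (trans (+-identityʳ _) (cong χ (+-identityʳ s))))
  ∑<-ballot-cubeSum N (suc j) a χ c χ≡0 c≤N mc≤1+a = begin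
    ∑< (suc N) (λ s → ballot a s * cubeSum (suc j) N (λ u → χ (s + u)))
      ≡⟨ ∑<-cong (suc N) (λ s → cong (ballot a s *_) (trans (cubeSum-suc j N (λ u → χ (s + u)))
           (∑<-cong (suc N) (λ d → cubeSum-cong j N (λ u → cong χ (sym (+-assoc s d u))))))) ⟩
    ∑< (suc N) (λ s → ballot a s * ∑< (suc N) (λ d → G (s + d)))
      ≡⟨ ∑<-prefixSum-exchange (suc N) (ballot a) G (λ t N<t → G≡0 t (≤-trans (s≤s c≤N) N<t)) ⟩
    ∑< (suc N) (λ u → G u * ∑< (suc u) (ballot a))
      ≡⟨ ∑<-cong (suc N) prefixSum ⟩
    ∑< (suc N) (λ u → ballot (suc a) u * G u)
      ≡⟨ ∑<-ballot-cubeSum N j (suc a) χ c χ≡0 c≤N (≤-trans mc≤1+a (n≤1+n (suc a))) ⟩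
    ∑< (suc N) (λ s → ballot (j + suc a) s * χ s)
      ≡⟨ ∑<-cong (suc N) (λ s → cong (λ a′ → ballot a′ s * χ s) (+-suc j a)) ⟩
    ∑< (suc N) (λ s → ballot (suc j + a) s * χ s) ∎
    where
    open ≡-Reasoning
    G : ℕ → ℕ
    G t = cubeSum j N (λ u → χ (t + u))
    G≡0 : ∀ t → c < t → G t ≡ 0
    G≡0 t c<t = cubeSum-zero j N (λ u → χ≡0 (t + u) (≤-trans c<t (m≤m+n t u)))
    prefixSum : ∀ u → G u * ∑< (suc u) (ballot a) ≡ ballot (suc a) u * G u
    prefixSum u with u ≤? c
    ... | yes u≤c = trans (cong (G u *_) (ballot-prefixSum a u (≤-trans (*-monoʳ-≤ m u≤c) mc≤1+a)))
                          (*-comm (G u) _)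
    ... | no  u≰c rewrite G≡0 u (≰⇒> u≰c) = sym (*-zeroʳ (ballot (suc a) u))

cutoff : ℕ → (ℕ → ℕ) → ℕ → ℕ
cutoff c φ u = if u <ᵇ c then φ u else 0

cutoff-vanish : ∀ c (φ : ℕ → ℕ) u → c ≤ u → cutoff c φ u ≡ 0
cutoff-vanish c φ u c≤u with u <ᵇ c | <ᵇ-reflects-< u c
... | true  | ofʸ u<c = contradiction c≤u (<⇒≱ u<c)
... | false | _       = refl

*-cutoff : ∀ c (φ g : ℕ → ℕ) → (∀ s → c ≤ s → g s ≡ 0) → ∀ s → g s * cutoff c φ s ≡ g s * φ s
*-cutoff c φ g g≡0 s with s <ᵇ c | <ᵇ-reflects-< s c
... | true  | _        = refl
... | false | ofⁿ s≮c  = trans (*-zeroʳ (g s)) (cong (_* φ s) (sym (g≡0 s (≮⇒≥ s≮c))))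

module _ (m′ N : ℕ) where

  private
    m = suc m′

  open Ballot m

  sumB : ℕ → (ℕ → ℕ) → ℕ
  sumB c φ = boxSum (λ k → B m c k * φ (V.sum k)) (replicate m N)

  sumB-1 : ∀ φ → sumB 1 φ ≡ φ 0
  sumB-1 φ = trans (cubeSum-origin m N (λ u → (if u <ᵇ 1 then 1 else 0) * φ u) (λ u → refl))
                   (+-identityʳ (φ 0))

  sumB-suc : ∀ c φ → suc c ≤ N →
    sumB (suc (suc c)) φ ≡ sumB (suc c) (λ t → cubeSum m N (λ u → cutoff (suc (suc c)) φ (t + u)))
  sumB-suc c φ c<N = trans (∑-cong (box (replicate m N)) unfoldB)
    (boxSum-prefixSum-exchange m N (B m (suc c)) (cutoff (suc (suc c)) φ)
      (λ u N<u → cutoff-vanish (suc (suc c)) φ u (≤-trans (s≤s c<N) N<u)))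
    where
    unfoldB : ∀ k → B m (suc (suc c)) k * φ (V.sum k)
                    ≡ cutoff (suc (suc c)) φ (V.sum k) * boxSum (B m (suc c)) k
    unfoldB k with V.sum k <ᵇ suc (suc c)
    ... | true  = *-comm (boxSum (B m (suc c)) k) (φ (V.sum k))
    ... | false = refl

  -- level c = m (c + 1) − 1, written so that suc (level c) is definitionally suc c * m.
  level : ℕ → ℕ
  level c = m′ + c * m

  ballot-level-vanish : ∀ c s → suc c ≤ s → ballot (level c) s ≡ 0
  ballot-level-vanish c (suc s) c<s =
    ballot-vanish (level c) s (≤-trans (*-monoˡ-≤ m c<s) (≤-reflexive (*-comm (suc s) m)))

  sumB≡∑ballot : ∀ c → suc c ≤ N → ∀ φ → sumB (suc c) φ ≡ ∑< (suc N) (λ s → ballot (level c) s * φ s)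
  sumB≡∑ballot zero c<N φ = trans (sumB-1 φ) (sym (begin
    ∑< (suc N) (λ s → ballot (level 0) s * φ s)
      ≡⟨ ∑<-head N _ ⟩
    (φ 0 + 0) + ∑< N (λ s → ballot (level 0) (suc s) * φ (suc s))
      ≡⟨ cong (φ 0 + 0 +_) (∑-zero (upTo N) (λ s →
           cong (_* φ (suc s)) (ballot-level-vanish 0 (suc s) (s≤s z≤n)))) ⟩
    (φ 0 + 0) + 0
      ≡⟨ trans (+-identityʳ _) (+-identityʳ (φ 0)) ⟩
    φ 0 ∎))
    where open ≡-Reasoning
  sumB≡∑ballot (suc c) c<N φ = begin
    sumB (suc (suc c)) φ
      ≡⟨ sumB-suc c φ c<N′ ⟩
    sumB (suc c) (λ t → cubeSum m N (λ u → χ (t + u)))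
      ≡⟨ sumB≡∑ballot c c<N′ _ ⟩
    ∑< (suc N) (λ s → ballot (level c) s * cubeSum m N (λ u → χ (s + u)))
      ≡⟨ ∑<-ballot-cubeSum N m (level c) χ (suc c) (cutoff-vanish (suc (suc c)) φ) c<N′
           (≤-reflexive (*-comm m (suc c))) ⟩
    ∑< (suc N) (λ s → ballot (m + level c) s * χ s)
      ≡⟨ ∑<-cong (suc N) (λ s → cong (λ a → ballot a s * χ s) (+-left-comm m m′ (c * m))) ⟩
    ∑< (suc N) (λ s → ballot (level (suc c)) s * χ s)
      ≡⟨ ∑<-cong (suc N) (*-cutoff (suc (suc c)) φ _ (ballot-level-vanish (suc c))) ⟩
    ∑< (suc N) (λ s → ballot (level (suc c)) s * φ s) ∎
    where
    open ≡-Reasoning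
    c<N′ : suc c ≤ N
    c<N′ = ≤-trans (n≤1+n (suc c)) c<N
    χ : ℕ → ℕ
    χ = cutoff (suc (suc c)) φ

open Ballot using (ballot; ballot-prefixSum; ballot-closedForm)

totalB≡ballot : ∀ m′ n → totalB (suc m′) (suc n) ≡ ballot (suc m′) (suc m′ * suc n) (suc n)
totalB≡ballot m′ n = begin
  totalB m N                        ≡⟨ ∑-cong (box (replicate m N)) (λ k → *-identityʳ (B m N k)) ⟨
  sumB m′ N N (λ _ → 1)             ≡⟨ sumB≡∑ballot m′ N n ≤-refl (λ _ → 1) ⟩
  ∑< (suc N) (λ s → ballot m a s * 1) ≡⟨ ∑<-cong (suc N) (λ s → *-identityʳ (ballot m a s)) ⟩
  ∑< (suc N) (ballot m a)           ≡⟨ ballot-prefixSum m a N (≤-reflexive (*-comm m N)) ⟩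
  ballot m (N * m) N                ≡⟨ cong (λ a′ → ballot m a′ N) (*-comm N m) ⟩
  ballot m (m * N) N                ∎
  where
  open ≡-Reasoning
  m = suc m′
  N = suc n
  a = level m′ N n

proposition3p1 : (p : ℕ) → 2 ≤ p → (n : ℕ) → 1 ≤ n →
    suc ((p ∸ 1) * n) * totalB (p ∸ 1) n ≡ (p * n) C n
proposition3p1 (suc zero)     (s≤s ())
proposition3p1 (suc (suc m′)) _ (suc n) _ = begin
  suc (m * N) * totalB m N          ≡⟨ cong (suc (m * N) *_) (totalB≡ballot m′ n) ⟩
  suc (m * N) * ballot m (m * N) N  ≡⟨ ballot-closedForm m n ⟩
  paths (m * N) N                   ≡⟨ paths≡C (m * N) N ⟩
  (m * N + N) C N                   ≡⟨ cong (_C N) (+-comm (m * N) N) ⟩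
  (N + m * N) C N                   ∎
  where
  open ≡-Reasoning
  m = suc m′
  N = suc n
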